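{- Let $G=(V,E)$ be a finite simple graph with $\alpha(G)\ge 3$. The following are equivalent: (i) $G$ is $\alpha^{+}$-stable; (ii) either $G$ is $\alpha_{P_3}^{+}$-stable, or there exist three distinct vertices $x,y,z\in V$ such that $|\{x,y\}\cap S|\cdot|\{x,z\}\cap S|\ge 2$ for every $S\in\Omega(G)$, and $x$ is the unique vertex of $G$ with this property (i.e., there is no vertex $x'\ne x$ for which there exist vertices $y',z'$ with $x',y',z'$ distinct and $|\{x',y'\}\cap S|\cdot|\{x',z'\}\cap S|\ge 2$ for every $S\in\Omega(G)$).
   Context: $\alpha(G)$ is the maximum size of a stable set; $\Omega(G)$ is the set of maximum stable sets. For $e\in E(\overline{G})$ (a pair of distinct non-adjacent vertices), $G+e$ denotes $G$ with $e$ added. $G$ is $\alpha^{+}$-stable if $\alpha(G+e)=\alpha(G)$ for every $e\in E(\overline{G})$. $G$ is $\alpha_{P_3}^{+}$-stable if $\alpha(G+e_1+e_2)=\alpha(G)$ for any $e_1,e_2\in E(\overline{G})$ (not necessarily distinct) having a common endpoint. -}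

module Defs where

open import Data.Nat using (ℕ; zero; suc; _⊔_; _*_; _≤_)
open import Data.Bool using (Bool; true; false; _∧_; _∨_; not; if_then_else_)
open import Data.Fin using (Fin)
open import Data.Fin.Properties using (_≟_)
open import Data.Fin.Subset using (Subset; _∈_; ∣_∣)
open import Data.Vec using (Vec; []; _∷_; lookup)
open import Data.List using (List; []; _∷_; map; foldr; filterᵇ; _++_; allFin)
open import Data.Bool.ListAction using (and)
open import Relation.Nullary.Decidable using (⌊_⌋)
open import Relation.Binary.PropositionalEquality using (_≡_; _≢_)
open import Data.Product using (_×_; ∃)
open import Data.Sum using (_⊎_)
open import Relation.Nullary using (¬_)

record Graph (n : ℕ) : Set where
  constructor mkGraph
  field adj : Fin n → Fin n → Bool
open Graph public

IsSimple : ∀ {n} → Graph n → Set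
IsSimple G = (∀ u v → adj G u v ≡ adj G v u) × (∀ u → adj G u u ≡ false)

_+E_ : ∀ {n} → Graph n → Fin n × Fin n → Graph n
_+E_ G (u Data.Product., v) = mkGraph λ a b →
  adj G a b ∨ ((⌊ a ≟ u ⌋ ∧ ⌊ b ≟ v ⌋) ∨ (⌊ a ≟ v ⌋ ∧ ⌊ b ≟ u ⌋))
infixl 6 _+E_

NonEdge : ∀ {n} → Graph n → Fin n → Fin n → Set
NonEdge G u v = u ≢ v × adj G u v ≡ false

Stable : ∀ {n} → Graph n → Subset n → Set
Stable G S = ∀ i j → i ∈ S → j ∈ S → adj G i j ≡ false

stableᵇ : ∀ {n} → Graph n → Subset n → Bool
stableᵇ {n} G S =
  and (map (λ i → and (map (λ j → not (lookup S i ∧ lookup S j ∧ adj G i j)) (allFin n))) (allFin n))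

allSubsets : (n : ℕ) → List (Subset n)
allSubsets zero = [] ∷ []
allSubsets (suc n) = map (true ∷_) (allSubsets n) ++ map (false ∷_) (allSubsets n)

α : ∀ {n} → Graph n → ℕ
α {n} G = foldr _⊔_ 0 (map ∣_∣ (filterᵇ (stableᵇ G) (allSubsets n)))

InΩ : ∀ {n} → Graph n → Subset n → Set
InΩ G S = Stable G S × ∣ S ∣ ≡ α G

-- |{a,b} ∩ S| for distinct a b
ind : ∀ {n} → Subset n → Fin n → ℕ
ind S a = if lookup S a then 1 else 0

pairCount : ∀ {n} → Subset n → Fin n → Fin n → ℕ
pairCount S a b = ind S a Data.Nat.+ ind S b

AlphaPlusStable : ∀ {n} → Graph n → Set
AlphaPlusStable G = ∀ u v → NonEdge G u v → α (G +E (u Data.Product., v)) ≡ α G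

-- G is α⁺_{P3}-stable: e₁ = xy, e₂ = xz non-edges of G with common endpoint x (y = z allowed)
AlphaP3Stable : ∀ {n} → Graph n → Set
AlphaP3Stable G = ∀ x y z → NonEdge G x y → NonEdge G x z →
  α (G +E (x Data.Product., y) +E (x Data.Product., z)) ≡ α G

HasProp : ∀ {n} → Graph n → Fin n → Set
HasProp G x = ∃ λ y → ∃ λ z → x ≢ y × x ≢ z × y ≢ z ×
  (∀ S → InΩ G S → 2 ≤ pairCount S x y * pairCount S x z)

{-# OPTIONS --safe #-}

-- Let core(G) be the set of vertices lying in every maximum stable set. Adding a
-- non-edge uv lowers α exactly when u, v ∈ core(G), so G is α⁺-stable iff core(G)
-- has at most one vertex; and a vertex with the property of the theorem lies in core(G).
-- (i) ⇒ (ii): if adding xy and xz lowers α, every maximum stable set contains x and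
-- one of y, z, so x has the property (y ≠ z since one non-edge does not lower α), and
-- it is the only such vertex because all of them lie in core(G).
-- (ii) ⇒ (i): α⁺_{P3}-stability with y = z is α⁺-stability. Otherwise, two vertices
-- u ≠ v of core(G) and a third vertex w (there are at least α(G) ≥ 3 vertices) give u
-- the property with witnesses v, w and v the property with u, w, contradicting uniqueness.

module Submission where

open import Defs
open import Data.Bool using (Bool; true; false; T; _∧_; not)
import Data.Bool as Bool
open import Data.Bool.ListAction using (all)
open import Data.Bool.Properties using (∨-zeroʳ; ∨-conicalˡ)
open import Data.Fin using (Fin; punchIn; punchOut) renaming (zero to 0F)
open import Data.Fin.Properties using (_≟_; all?; ¬∀⟶∃¬; punchInᵢ≢i; punchIn-injective; punchIn-punchOut)
open import Data.Fin.Subset using (Subset; _∈_; ∣_∣; ⊥)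
open import Data.Fin.Subset.Properties using (_∈?_; ∣p∣≤n; ∉⊥; ∣⊥∣≡0)
open import Data.List using (map; filterᵇ; allFin)
open import Data.List.Membership.Propositional using () renaming (_∈_ to _∈ₗ_)
open import Data.List.Membership.Propositional.Properties
  using (∈-allFin; ∈-map⁺; ∈-map⁻; ∈-++⁺ˡ; ∈-++⁺ʳ; ∈-filter⁺; ∈-filter⁻; foldr-selective)
open import Data.List.Properties using (foldr-preservesᵒ)
import Data.List.Relation.Unary.All as All
open import Data.List.Relation.Unary.All.Properties using (all⁺; all⁻)
import Data.List.Relation.Unary.Any as Any
open import Data.Nat using (ℕ; suc; _≤_; _*_; s≤s)
open import Data.Nat.Properties using (⊔-sel; ≤-trans; ≤-antisym; ≤-reflexive; m≤n⇒m≤n⊔o; m≤n⇒m≤o⊔n; m≤m*n; m≤n*m)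
import Data.Nat.Properties as ℕ
open import Data.Product using (_×_; ∃; _,_; proj₁; proj₂; uncurry)
open import Data.Sum using (_⊎_; inj₁; inj₂; [_,_])
open import Data.Vec using ([]; _∷_; lookup)
open import Data.Vec.Properties using ([]=⇒lookup; lookup⇒[]=)
open import Function using (_∘_)
open import Function.Bundles using (_⇔_; mk⇔; Equivalence)
open import Relation.Binary.PropositionalEquality using (_≡_; refl; sym; trans; subst; _≢_)
open import Relation.Nullary using (¬_; Dec; yes; no; contradiction)
open import Relation.Nullary.Decidable using (_×-dec_; _⊎-dec_; _→-dec_; ¬?; decidable-stable; T?)

private
  variable
    n : ℕ
    S : Subset n
    u v x y z : Fin n

+E-adj-new : (G : Graph n) (u v : Fin n) → adj (G +E (u , v)) u v ≡ true
+E-adj-new G u v with u ≟ u | v ≟ v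
... | yes _   | yes _   = ∨-zeroʳ (adj G u v)
... | no u≢u  | _       = contradiction refl u≢u
... | yes _   | no v≢v  = contradiction refl v≢v

+E-adj⁻ : (G : Graph n) (u v : Fin n) {i j : Fin n} → adj (G +E (u , v)) i j ≡ true →
          adj G i j ≡ true ⊎ (i ≡ u × j ≡ v) ⊎ (i ≡ v × j ≡ u)
+E-adj⁻ G u v {i} {j} h with adj G i j | i ≟ u | j ≟ v | i ≟ v | j ≟ u
... | true  | _      | _      | _      | _      = inj₁ refl
... | false | yes p  | yes q  | _      | _      = inj₂ (inj₁ (p , q))
... | false | _      | _      | yes p  | yes q  = inj₂ (inj₂ (p , q))
... | false | no _   | _      | no _   | _      = contradiction h λ ()
... | false | no _   | _      | yes _  | no _   = contradiction h λ ()
... | false | yes _  | no _   | no _   | _      = contradiction h λ ()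
... | false | yes _  | no _   | yes _  | no _   = contradiction h λ ()

stable-+E⁻ : (G : Graph n) → Stable (G +E (u , v)) S → Stable G S
stable-+E⁻ G st i j i∈S j∈S = ∨-conicalˡ _ _ (st i j i∈S j∈S)

stable-+E : (G : Graph n) → Stable G S → ¬ (u ∈ S × v ∈ S) → Stable (G +E (u , v)) S
stable-+E {u = u} {v = v} G st ¬uv∈S i j i∈S j∈S with adj (G +E (u , v)) i j in e
... | false = refl
... | true with +E-adj⁻ G u v e
...   | inj₁ ij∈G                = contradiction (trans (sym ij∈G) (st i j i∈S j∈S)) λ ()
...   | inj₂ (inj₁ (refl , refl)) = contradiction (i∈S , j∈S) ¬uv∈S
...   | inj₂ (inj₂ (refl , refl)) = contradiction (j∈S , i∈S) ¬uv∈S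

nand-elim : ∀ {a b c} → T (not (a ∧ b ∧ c)) → a ≡ true → b ≡ true → c ≡ false
nand-elim {c = false} _ refl refl = refl
nand-elim {c = true}  () refl refl

nand-intro : ∀ a b c → (a ≡ true → b ≡ true → c ≡ false) → T (not (a ∧ b ∧ c))
nand-intro false _     _ _ = _
nand-intro true  false _ _ = _
nand-intro true  true  c h rewrite h refl refl = _

module _ (G : Graph n) (S : Subset n) where

  private
    independentᵇ : Fin n → Fin n → Bool
    independentᵇ i j = not (lookup S i ∧ lookup S j ∧ adj G i j)

  stable⇒stableᵇ : Stable G S → T (stableᵇ G S)
  stable⇒stableᵇ st = all⁻ (λ i → all (independentᵇ i) (allFin n)) {allFin n} (All.tabulate λ {i} _ →
    all⁻ (independentᵇ i) {allFin n} (All.tabulate λ {j} _ →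
      nand-intro _ _ _ λ i∈S j∈S → st i j (lookup⇒[]= i S i∈S) (lookup⇒[]= j S j∈S)))

  stableᵇ⇒stable : T (stableᵇ G S) → Stable G S
  stableᵇ⇒stable h i j i∈S j∈S = nand-elim independent ([]=⇒lookup i∈S) ([]=⇒lookup j∈S)
    where
    row : T (all (independentᵇ i) (allFin n))
    row = All.lookup (all⁺ _ (allFin n) h) (∈-allFin i)
    independent : T (independentᵇ i j)
    independent = All.lookup (all⁺ (independentᵇ i) (allFin n) row) (∈-allFin j)

∈-allSubsets : (S : Subset n) → S ∈ₗ allSubsets n
∈-allSubsets []          = Any.here refl
∈-allSubsets (true ∷ S)  = ∈-++⁺ˡ (∈-map⁺ (true ∷_) (∈-allSubsets S))
∈-allSubsets (false ∷ S) = ∈-++⁺ʳ _ (∈-map⁺ (false ∷_) (∈-allSubsets S))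

stable⇒∣∣≤α : (G : Graph n) → Stable G S → ∣ S ∣ ≤ α G
stable⇒∣∣≤α {S = S} G st = foldr-preservesᵒ (λ a b → [ m≤n⇒m≤n⊔o b , m≤n⇒m≤o⊔n a ]) 0 _
  (inj₂ (Any.map ≤-reflexive (∈-map⁺ ∣_∣ (∈-filter⁺ (T? ∘ stableᵇ G) (∈-allSubsets S) (stable⇒stableᵇ G S st)))))

Ω-nonempty : (G : Graph n) → ∃ (InΩ G)
Ω-nonempty {n} G with foldr-selective ⊔-sel 0 (map ∣_∣ (filterᵇ (stableᵇ G) (allSubsets n)))
... | inj₁ α≡0 = ⊥ , (λ _ _ i∈⊥ → contradiction i∈⊥ ∉⊥) , trans (∣⊥∣≡0 n) (sym α≡0)
... | inj₂ α∈ with S , S∈ , α≡∣S∣ ← ∈-map⁻ ∣_∣ α∈ =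
  S , stableᵇ⇒stable G S (proj₂ (∈-filter⁻ (T? ∘ stableᵇ G) {xs = allSubsets n} S∈)) , sym α≡∣S∣

α≤n : (G : Graph n) → α G ≤ n
α≤n {n} G with S , _ , ∣S∣≡α ← Ω-nonempty G = subst (_≤ n) ∣S∣≡α (∣p∣≤n S)

α-+E-≤ : (G : Graph n) (u v : Fin n) → α (G +E (u , v)) ≤ α G
α-+E-≤ G u v with S , st , ∣S∣≡α ← Ω-nonempty (G +E (u , v)) = subst (_≤ α G) ∣S∣≡α (stable⇒∣∣≤α G (stable-+E⁻ G st))

α-≡-if-Ω-stable : (G H : Graph n) → InΩ G S → Stable H S → α H ≤ α G → α H ≡ α G
α-≡-if-Ω-stable G H (_ , ∣S∣≡α) st α≤ = ≤-antisym α≤ (subst (_≤ α H) ∣S∣≡α (stable⇒∣∣≤α H st))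

α-+E-edge : (G : Graph n) → adj G u v ≡ true → α (G +E (u , v)) ≡ α G
α-+E-edge {u = u} {v = v} G uv∈G with S , S∈Ω@(st , _) ← Ω-nonempty G =
  α-≡-if-Ω-stable G (G +E (u , v)) S∈Ω
    (stable-+E G st λ (u∈S , v∈S) → contradiction (trans (sym uv∈G) (st u v u∈S v∈S)) λ ())
    (α-+E-≤ G u v)

InCore : Graph n → Fin n → Set
InCore G v = ∀ S → InΩ G S → v ∈ S

SubsingletonCore : Graph n → Set
SubsingletonCore {n} G = ∀ (u v : Fin n) → InCore G u → InCore G v → u ≡ v

inCore-nonadjacent : (G : Graph n) → InCore G u → InCore G v → adj G u v ≡ false
inCore-nonadjacent {u = u} {v = v} G u∈core v∈core with S , S∈Ω ← Ω-nonempty G =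
  proj₁ S∈Ω u v (u∈core S S∈Ω) (v∈core S S∈Ω)

α-+E-≢⇒inCore : (G : Graph n) → α (G +E (u , v)) ≢ α G → InCore G u × InCore G v
α-+E-≢⇒inCore {u = u} {v = v} G α≢ = (λ S S∈Ω → proj₁ (both S S∈Ω)) , (λ S S∈Ω → proj₂ (both S S∈Ω))
  where
  both : ∀ S → InΩ G S → u ∈ S × v ∈ S
  both S S∈Ω = decidable-stable (u ∈? S ×-dec v ∈? S) λ ¬both →
    α≢ (α-≡-if-Ω-stable G (G +E (u , v)) S∈Ω (stable-+E G (proj₁ S∈Ω) ¬both) (α-+E-≤ G u v))

inCore⇒α-+E-≢ : (G : Graph n) → InCore G u → InCore G v → α (G +E (u , v)) ≢ α G
inCore⇒α-+E-≢ {u = u} {v = v} G u∈core v∈core α≡ with S , st , ∣S∣≡α ← Ω-nonempty (G +E (u , v)) =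
  contradiction (trans (sym (+E-adj-new G u v)) (st u v (u∈core S S∈Ω) (v∈core S S∈Ω))) λ ()
  where
  S∈Ω : InΩ G S
  S∈Ω = stable-+E⁻ G st , trans ∣S∣≡α α≡

alphaPlusStable⇔subsingletonCore : (G : Graph n) → AlphaPlusStable G ⇔ SubsingletonCore G
alphaPlusStable⇔subsingletonCore G = mk⇔ to from
  where
  to : AlphaPlusStable G → SubsingletonCore G
  to α⁺ u v u∈core v∈core with u ≟ v
  ... | yes u≡v = u≡v
  ... | no u≢v  = contradiction (α⁺ u v (u≢v , inCore-nonadjacent G u∈core v∈core)) (inCore⇒α-+E-≢ G u∈core v∈core)
  from : SubsingletonCore G → AlphaPlusStable G
  from core≤1 u v (u≢v , _) = decidable-stable (α (G +E (u , v)) ℕ.≟ α G) λ α≢ →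
    u≢v (uncurry (core≤1 u v) (α-+E-≢⇒inCore G α≢))

pairCount-*-≥2 : x ∈ S → y ∈ S ⊎ z ∈ S → 2 ≤ pairCount S x y * pairCount S x z
pairCount-*-≥2 {S = S} {y = y} {z = z} x∈S y∨z∈S rewrite []=⇒lookup x∈S with y∨z∈S
... | inj₁ y∈S rewrite []=⇒lookup y∈S = m≤m*n 2 (suc (ind S z))
... | inj₂ z∈S rewrite []=⇒lookup z∈S = m≤n*m 2 (suc (ind S y))

pairCount-*-≥2⇒∈ : (S : Subset n) (x y z : Fin n) → 2 ≤ pairCount S x y * pairCount S x z → x ∈ S
pairCount-*-≥2⇒∈ S x y z h with lookup S x in x∈S
... | true = lookup⇒[]= x S x∈S
... | false with lookup S y | lookup S z | h
...   | true  | true  | s≤s ()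
...   | true  | false | ()
...   | false | _     | ()

hasProp⇒inCore : (G : Graph n) → HasProp G x → InCore G x
hasProp⇒inCore G (y , z , _ , _ , _ , h) S S∈Ω = pairCount-*-≥2⇒∈ S _ y z (h S S∈Ω)

fresh-vertex : 3 ≤ n → (u v : Fin n) → ∃ λ w → u ≢ w × v ≢ w
fresh-vertex (s≤s (s≤s (s≤s _))) u v with u ≟ v
... | yes refl = punchIn u 0F , punchInᵢ≢i u 0F ∘ sym , punchInᵢ≢i u 0F ∘ sym
... | no u≢v   = punchIn u (punchIn v′ 0F) , punchInᵢ≢i u _ ∘ sym , λ v≡w →
  punchInᵢ≢i v′ 0F (sym (punchIn-injective u v′ _ (trans (punchIn-punchOut u≢v) v≡w)))
  where
  -- v = punchIn u v′, and punchIn v′ 0F ≢ v′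
  v′ : Fin _
  v′ = punchOut u≢v

HasPropUniquely : Graph n → Fin n → Set
HasPropUniquely G x = HasProp G x × (∀ x′ → HasProp G x′ → x′ ≡ x)

inCore⇒hasProp : (G : Graph n) → 3 ≤ n → InCore G u → InCore G v → u ≢ v → HasProp G u
inCore⇒hasProp {u = u} {v = v} G 3≤n u∈core v∈core u≢v with w , u≢w , v≢w ← fresh-vertex 3≤n u v =
  v , w , u≢v , u≢w , v≢w , λ S S∈Ω → pairCount-*-≥2 (u∈core S S∈Ω) (inj₁ (v∈core S S∈Ω))

hasPropUniquely⇒subsingletonCore : (G : Graph n) → 3 ≤ n → HasPropUniquely G x → SubsingletonCore G
hasPropUniquely⇒subsingletonCore G 3≤n (_ , unique) u v u∈core v∈core with u ≟ v
... | yes u≡v = u≡v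
... | no u≢v  = trans (unique u (inCore⇒hasProp G 3≤n u∈core v∈core u≢v))
                      (sym (unique v (inCore⇒hasProp G 3≤n v∈core u∈core (u≢v ∘ sym))))

α-+E-+E-≢⇒∈ : (G : Graph n) → α (G +E (x , y) +E (x , z)) ≢ α G → InΩ G S → x ∈ S × (y ∈ S ⊎ z ∈ S)
α-+E-+E-≢⇒∈ {x = x} {y = y} {z = z} {S = S} G α≢ S∈Ω@(st , _) =
  decidable-stable (x ∈? S ×-dec (y ∈? S ⊎-dec z ∈? S)) λ ∉ →
    α≢ (α-≡-if-Ω-stable G (G +E (x , y) +E (x , z)) S∈Ω
         (stable-+E (G +E (x , y)) (stable-+E G st λ (x∈S , y∈S) → ∉ (x∈S , inj₁ y∈S))
                                   λ (x∈S , z∈S) → ∉ (x∈S , inj₂ z∈S))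
         (≤-trans (α-+E-≤ (G +E (x , y)) x z) (α-+E-≤ G x y)))

AlphaP3Violation : Graph n → Fin n → Fin n → Fin n → Set
AlphaP3Violation G x y z = NonEdge G x y × NonEdge G x z × α (G +E (x , y) +E (x , z)) ≢ α G

alphaPlusStable∧violation⇒hasProp : (G : Graph n) → AlphaPlusStable G → AlphaP3Violation G x y z → HasProp G x
alphaPlusStable∧violation⇒hasProp {x = x} {y = y} {z = z} G α⁺ (xy∉G , xz∉G , α≢) =
  y , z , proj₁ xy∉G , proj₁ xz∉G , y≢z , λ S S∈Ω → uncurry pairCount-*-≥2 (α-+E-+E-≢⇒∈ G α≢ S∈Ω)
  where
  y≢z : y ≢ z
  y≢z refl = α≢ (trans (α-+E-edge (G +E (x , y)) (+E-adj-new G x y)) (α⁺ x y xy∉G))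

alphaP3Stable⇒alphaPlusStable : (G : Graph n) → AlphaP3Stable G → AlphaPlusStable G
alphaP3Stable⇒alphaPlusStable G p3 u v uv∉G =
  trans (sym (α-+E-edge (G +E (u , v)) (+E-adj-new G u v))) (p3 u v v uv∉G uv∉G)

module _ (G : Graph n) where

  private
    nonEdge? : ∀ u v → Dec (NonEdge G u v)
    nonEdge? u v = ¬? (u ≟ v) ×-dec (adj G u v Bool.≟ false)

    stableAt? : ∀ x y z → Dec (NonEdge G x y → NonEdge G x z → α (G +E (x , y) +E (x , z)) ≡ α G)
    stableAt? x y z = nonEdge? x y →-dec nonEdge? x z →-dec α (G +E (x , y) +E (x , z)) ℕ.≟ α G

  alphaP3Stable? : Dec (AlphaP3Stable G)
  alphaP3Stable? = all? λ x → all? λ y → all? (stableAt? x y)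

  ¬alphaP3Stable⇒violation : ¬ AlphaP3Stable G → ∃ λ x → ∃ λ y → ∃ λ z → AlphaP3Violation G x y z
  ¬alphaP3Stable⇒violation ¬p3
    with x , ¬p3-x ← ¬∀⟶∃¬ n _ (λ x → all? λ y → all? (stableAt? x y)) ¬p3
    with y , ¬p3-xy ← ¬∀⟶∃¬ n _ (λ y → all? (stableAt? x y)) ¬p3-x
    with z , ¬p3-xyz ← ¬∀⟶∃¬ n _ (stableAt? x y) ¬p3-xy
    = x , y , z
    , decidable-stable (nonEdge? x y) (λ ¬xy → ¬p3-xyz λ xy → contradiction xy ¬xy)
    , decidable-stable (nonEdge? x z) (λ ¬xz → ¬p3-xyz λ _ xz → contradiction xz ¬xz)
    , λ α≡ → ¬p3-xyz λ _ _ → α≡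

alphaPlusStable∧violation⇒hasPropUniquely : (G : Graph n) → AlphaPlusStable G → AlphaP3Violation G x y z →
  HasPropUniquely G x
alphaPlusStable∧violation⇒hasPropUniquely {x = x} G α⁺ violation = x-hasProp , λ x′ x′-hasProp →
  Equivalence.to (alphaPlusStable⇔subsingletonCore G) α⁺ x′ x (hasProp⇒inCore G x′-hasProp) (hasProp⇒inCore G x-hasProp)
  where
  x-hasProp : HasProp G x
  x-hasProp = alphaPlusStable∧violation⇒hasProp G α⁺ violation

proposition4 : ∀ {n} (G : Graph n) → IsSimple G → 3 ≤ α G →
    AlphaPlusStable G ⇔
      (AlphaP3Stable G ⊎ (∃ λ x → HasProp G x × (∀ x′ → HasProp G x′ → x′ ≡ x)))
proposition4 {n} G _ 3≤α = mk⇔ forward backward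
  where
  3≤n : 3 ≤ n
  3≤n = ≤-trans 3≤α (α≤n G)
  forward : AlphaPlusStable G → AlphaP3Stable G ⊎ ∃ (HasPropUniquely G)
  forward α⁺ with alphaP3Stable? G
  ... | yes p3 = inj₁ p3
  ... | no ¬p3 = let x , _ , _ , violation = ¬alphaP3Stable⇒violation G ¬p3
                 in inj₂ (x , alphaPlusStable∧violation⇒hasPropUniquely G α⁺ violation)
  backward : AlphaP3Stable G ⊎ ∃ (HasPropUniquely G) → AlphaPlusStable G
  backward (inj₁ p3)              = alphaP3Stable⇒alphaPlusStable G p3
  backward (inj₂ (_ , x-hasPropUniquely)) =
    Equivalence.from (alphaPlusStable⇔subsingletonCore G) (hasPropUniquely⇒subsingletonCore G 3≤n x-hasPropUniquely)
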